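{- Let $R$ be an integral domain and $\kappa\in R$. Suppose $f\in R[x,y,z]$ and $\lambda\in R$ satisfy $\Phi_x(xf)=\lambda\,\Phi_x(f)$. Then $\sum_{\mathbf{t}\in\mathscr{O}_\alpha}f(\mathbf{t})=0$ for every finite first-coordinate orbit $\mathscr{O}_\alpha$ with $\alpha\neq\lambda$.
   Context: $\mathscr{M}(R)$ is the set of $(x,y,z)\in R^3$ with $x^2+y^2+z^2=xyz+\kappa$. $\Gamma$ is the group of maps on $R^3$ generated by the Vieta involutions $(x,y,z)\mapsto(yz-x,y,z)$, $(x,y,z)\mapsto(x,xz-y,z)$, $(x,y,z)\mapsto(x,y,xy-z)$, the coordinate permutations, and $(x,y,z)\mapsto(x,-y,-z)$; $\Gamma_x$ is the subgroup of elements preserving the first coordinate of every point. A first-coordinate orbit $\mathscr{O}_\alpha$ is a set $\Gamma_x\cdot\mathbf{t}$ for some $\mathbf{t}\in\mathscr{M}(R)$ whose first coordinate is $\alpha$. $\Phi_x$ is the $R$-linear map on $R[x,y,z]$ defined on monomials by recursion on total degree: for $\ell,m,n\ge1$, $\Phi_x(x^\ell y^mz^n)=\Phi_x\big(x^{\ell-1}y^{m-1}z^{n-1}(x^2+y^2+z^2-\kappa)\big)$; for $\ell,m\ge1$, $\Phi_x(x^\ell y^m)=\Phi_x(2x^{\ell-1}y^{m-1}z)$; for $\ell,n\ge1$, $\Phi_x(x^\ell z^n)=\Phi_x(2x^{\ell-1}yz^{n-1})$; $\Phi_x(x^\ell)=x^\ell$; $\Phi_x(y^mz^n)=y^mz^n$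 if $m\ge n$ and $=y^nz^m$ if $n>m$. -}

module Defs where

open import Level using (Level; _⊔_)
open import Algebra.Bundles using (CommutativeRing)
open import Data.Nat as ℕ using (ℕ; zero; suc)
open import Data.Nat.Properties using (_≟_)
open import Data.Product using (_×_; _,_; proj₁; proj₂; Σ; ∃)
open import Data.Sum using (_⊎_)
open import Data.List using (List; []; _∷_; _++_; map; foldr)
open import Data.Empty using (⊥)
open import Relation.Nullary using (¬_; yes; no)
open import Relation.Binary.Bundles using (Setoid)
open import Data.Product.Relation.Binary.Pointwise.NonDependent using (×-setoid)
import Data.List.Relation.Unary.Unique.Setoid as UniqueS
import Data.List.Membership.Setoid as MemS

record IsIntegralDomain {c ℓ} (R : CommutativeRing c ℓ) : Set (c ⊔ ℓ) where
  open CommutativeRing R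
  field
    1≉0          : ¬ (1# ≈ 0#)
    noZeroDivisors : ∀ a b → a * b ≈ 0# → (a ≈ 0#) ⊎ (b ≈ 0#)

module Markoff {c ℓ} (R : CommutativeRing c ℓ) (κ : CommutativeRing.Carrier R) where
  open CommutativeRing R

  _^_ : Carrier → ℕ → Carrier
  a ^ zero  = 1#
  a ^ suc n = a * (a ^ n)

  -- Polynomials in R[x,y,z], as formal finite sums of terms c·x^ℓ y^m z^n.
  -- A term (c , ℓ , m , n) stands for c x^ℓ y^m z^n.
  Term : Set c
  Term = Carrier × ℕ × ℕ × ℕ

  Poly : Set c
  Poly = List Term

  coeff : Poly → ℕ → ℕ → ℕ → Carrier
  coeff [] l m n = 0#
  coeff ((a , l' , m' , n') ∷ p) l m n with l' ≟ l | m' ≟ m | n' ≟ n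
  ... | yes _ | yes _ | yes _ = a + coeff p l m n
  ... | _     | _     | _     = coeff p l m n

  _≈ₚ_ : Poly → Poly → Set ℓ
  p ≈ₚ q = ∀ l m n → coeff p l m n ≈ coeff q l m n

  scale : Carrier → Poly → Poly
  scale a = map (λ { (b , l , m , n) → (a * b , l , m , n) })

  mulX : Poly → Poly
  mulX = map (λ { (b , l , m , n) → (b , suc l , m , n) })

  eval : Poly → Carrier × Carrier × Carrier → Carrier
  eval p (x , y , z) =
    foldr (λ { (a , l , m , n) s → a * ((x ^ l) * ((y ^ m) * (z ^ n))) + s }) 0# p

  -- Φ_x on monomials, by recursion on total degree (using fuel;
  -- fuel ℓ+m+n+1 always suffices since each recursive step lowers the
  -- total degree, so the fuel-out clause is never reached).
  Φmono : ℕ → ℕ → ℕ → ℕ → Poly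
  Φmono zero _ _ _ = []
  -- ℓ,m,n ≥ 1 : x^{ℓ-1}y^{m-1}z^{n-1}(x²+y²+z²-κ)
  Φmono (suc k) (suc l) (suc m) (suc n) =
    Φmono k (suc (suc l)) m n ++ (Φmono k l (suc (suc m)) n ++
      (Φmono k l m (suc (suc n)) ++ scale (- κ) (Φmono k l m n)))
  Φmono (suc k) (suc l) (suc m) zero = scale (1# + 1#) (Φmono k l m 1)
  Φmono (suc k) (suc l) zero (suc n) = scale (1# + 1#) (Φmono k l 1 n)
  Φmono (suc k) l zero zero = (1# , l , 0 , 0) ∷ []
  Φmono (suc k) zero m n with m ℕ.<? n
  ... | yes _ = (1# , 0 , n , m) ∷ []
  ... | no  _ = (1# , 0 , m , n) ∷ []

  Φx : Poly → Poly
  Φx [] = []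
  Φx ((a , l , m , n) ∷ p) = scale a (Φmono (suc (l ℕ.+ m ℕ.+ n)) l m n) ++ Φx p

  Pt : Set c
  Pt = Carrier × Carrier × Carrier

  PtSetoid : Setoid c ℓ
  PtSetoid = ×-setoid setoid (×-setoid setoid setoid)

  _≈³_ : Pt → Pt → Set ℓ
  _≈³_ = Setoid._≈_ PtSetoid

  inM : Pt → Set ℓ
  inM (x , y , z) = (x * x) + ((y * y) + (z * z)) ≈ (x * (y * z)) + κ

  -- Generators of Γ (all are involutions or permutations, so Γ is the
  -- set of maps given by finite words in the generators)
  data Gen : Set where
    vieta₁ vieta₂ vieta₃ : Gen
    perm-xzy perm-yxz perm-yzx perm-zxy perm-zyx : Gen
    negYZ : Gen

  actGen : Gen → Pt → Pt
  actGen vieta₁ (x , y , z) = ((y * z) - x , y , z)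
  actGen vieta₂ (x , y , z) = (x , (x * z) - y , z)
  actGen vieta₃ (x , y , z) = (x , y , (x * y) - z)
  actGen perm-xzy (x , y , z) = (x , z , y)
  actGen perm-yxz (x , y , z) = (y , x , z)
  actGen perm-yzx (x , y , z) = (y , z , x)
  actGen perm-zxy (x , y , z) = (z , x , y)
  actGen perm-zyx (x , y , z) = (z , y , x)
  actGen negYZ    (x , y , z) = (x , - y , - z)

  Word : Set
  Word = List Gen

  act : Word → Pt → Pt
  act [] p = p
  act (g ∷ w) p = actGen g (act w p)

  InΓx : Word → Set (c ⊔ ℓ)
  InΓx w = ∀ p → proj₁ (act w p) ≈ proj₁ p

  InOrbit : Pt → Pt → Set (c ⊔ ℓ)
  InOrbit t p = Σ Word λ w → InΓx w × (act w t ≈³ p)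

  open MemS PtSetoid using () renaming (_∈_ to _∈ₚ_)
  open UniqueS PtSetoid using () renaming (Unique to UniqueₚList)

  -- ts is a duplicate-free enumeration of the orbit Γ_x · t
  -- (such a list exists iff the orbit is finite)
  EnumeratesOrbit : Pt → List Pt → Set (c ⊔ ℓ)
  EnumeratesOrbit t ts =
    UniqueₚList ts × ((∀ p → p ∈ₚ ts → InOrbit t p) × (∀ p → InOrbit t p → p ∈ₚ ts))

  sumOver : Poly → List Pt → Carrier
  sumOver f ts = foldr (λ p s → eval f p + s) 0# ts

module Submission where

-- Let O = Γ_x · t be a finite orbit with first coordinate α and S(f) = Σ_{p ∈ O} f(p).
-- Every rewriting rule defining Φ_x preserves S: on the surface xyz = x² + y² + z² − κ;
-- xy = z + (xy − z), and the two summands are exchanged by the Vieta involution in z,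
-- which fixes x and hence permutes O (likewise xz and the involution in y); and the
-- swap y ↔ z permutes O.  Hence S(Φ_x f) = S(f).  As x ≡ α on O,
--   α S(f) = S(xf) = S(Φ_x(xf)) = λ S(Φ_x f) = λ S(f),
-- and α ≠ λ in an integral domain forces S(f) = 0.

open import Defs
open import Algebra.Bundles using (CommutativeRing)
open import Data.Nat as ℕ using (ℕ; zero; suc; _≤_; _<_; s≤s)
import Data.Nat.Properties as ℕ
open import Data.Nat.Tactic.RingSolver using (solve-∀)
open import Data.Product using (_×_; _,_; proj₁; proj₂)
open import Data.Product.Properties using (≡-dec)
open import Data.Sum using ([_,_]′)
open import Data.List using (List; []; _∷_; _++_; map; foldr; filter; length)
open import Data.List.Properties using (filter-reject; length-filter; foldr-map)
open import Data.List.Relation.Unary.Any using (here; there)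
open import Data.List.Relation.Unary.AllPairs.Core using (_∷_)
open import Function using (_∘_; id)
open import Relation.Binary.Bundles using (Setoid)
open import Relation.Binary.Core using (_Preserves_⟶_)
open import Relation.Binary.Definitions using (DecidableEquality)
import Relation.Unary as U
open import Relation.Binary.PropositionalEquality as ≡ using (_≡_; _≢_)
open import Relation.Nullary using (¬_; yes; no; ¬?; contradiction)
import Data.List.Membership.Setoid as Membership
import Data.List.Membership.Setoid.Properties as MembershipProps
import Data.List.Relation.Binary.Permutation.Setoid as Permutation
import Data.List.Relation.Binary.Permutation.Setoid.Properties as PermutationProps
import Data.List.Relation.Binary.Subset.Setoid as Subset
import Data.List.Relation.Unary.Unique.Setoid as UniqueS
import Data.List.Relation.Unary.Unique.Setoid.Properties as UniqueProps

module _ {a ℓ₁} (S : Setoid a ℓ₁) where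
  open Setoid S renaming (Carrier to A)
  open Membership S using (_∈_; _─_)
  open MembershipProps using (∈-resp-≈; All[≉]⇒∉; ∈-map⁺; ∈-map⁻)
  open Permutation S using (_↭_; ↭-refl; ↭-sym; ↭-trans; ↭-prep; ↭-swap)
  open PermutationProps S using (∈-resp-↭; Unique-resp-↭)
  open Subset S using (_⊆_)
  open UniqueS S using (Unique)

  ↭-─ : ∀ {v ys} (v∈ys : v ∈ ys) → ys ↭ v ∷ (ys ─ v∈ys)
  ↭-─ (here v≈y)                = Permutation.prep (sym v≈y) ↭-refl
  ↭-─ {ys = y ∷ _} (there v∈ys) = ↭-trans (↭-prep y (↭-─ v∈ys)) (↭-swap y _ ↭-refl)

  unique-∈-tail⇒≉-head : ∀ {x y xs} → Unique (x ∷ xs) → y ∈ xs → ¬ y ≈ x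
  unique-∈-tail⇒≉-head (x≉xs ∷ _) y∈xs y≈x = All[≉]⇒∉ S x≉xs (∈-resp-≈ S y≈x y∈xs)

  unique-⊆-⊇⇒↭ : ∀ {xs ys} → Unique xs → Unique ys → xs ⊆ ys → ys ⊆ xs → xs ↭ ys
  unique-⊆-⊇⇒↭ {[]} {[]}    _ _ _ _ = ↭-refl
  unique-⊆-⊇⇒↭ {[]} {_ ∷ _} _ _ _ ys⊆[] with ys⊆[] (here refl)
  ... | ()
  unique-⊆-⊇⇒↭ {x ∷ xs} {ys} uxs@(_ ∷ uxs′) uys xs⊆ys ys⊆xs =
    ↭-trans (↭-prep x (unique-⊆-⊇⇒↭ uxs′ uys′ xs⊆ys′ ys′⊆xs)) (↭-sym ys↭)
    where
      x∈ys = xs⊆ys (here refl)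
      ys′  = ys ─ x∈ys
      ys↭ : ys ↭ x ∷ ys′
      ys↭ = ↭-─ x∈ys
      uxys′ : Unique (x ∷ ys′)
      uxys′ = Unique-resp-↭ ys↭ uys
      uys′ : Unique ys′
      uys′ with _ ∷ u ← uxys′ = u
      xs⊆ys′ : xs ⊆ ys′
      xs⊆ys′ y∈xs with ∈-resp-↭ ys↭ (xs⊆ys (there y∈xs))
      ... | here y≈x    = contradiction y≈x (unique-∈-tail⇒≉-head uxs y∈xs)
      ... | there y∈ys′ = y∈ys′
      ys′⊆xs : ys′ ⊆ xs
      ys′⊆xs y∈ys′ with ys⊆xs (∈-resp-↭ (↭-sym ys↭) (there y∈ys′))
      ... | here y≈x   = contradiction y≈x (unique-∈-tail⇒≉-head uxys′ y∈ys′)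
      ... | there y∈xs = y∈xs

  involution-map-↭ : ∀ {f : A → A} → f Preserves _≈_ ⟶ _≈_ → (∀ x → f (f x) ≈ x) →
                     ∀ {xs} → Unique xs → (∀ {x} → x ∈ xs → f x ∈ xs) → map f xs ↭ xs
  involution-map-↭ {f} f-cong ff≈id uxs closed =
    unique-⊆-⊇⇒↭ (UniqueProps.map⁺ S S f-injective uxs) uxs fxs⊆xs xs⊆fxs
    where
      f-injective : ∀ {x y} → f x ≈ f y → x ≈ y
      f-injective fx≈fy = trans (sym (ff≈id _)) (trans (f-cong fx≈fy) (ff≈id _))
      fxs⊆xs : map f _ ⊆ _
      fxs⊆xs y∈fxs with ∈-map⁻ S S y∈fxs
      ... | _ , x∈xs , y≈fx = ∈-resp-≈ S (sym y≈fx) (closed x∈xs)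
      xs⊆fxs : _ ⊆ map f _
      xs⊆fxs x∈xs = ∈-resp-≈ S (ff≈id _) (∈-map⁺ S S f-cong (closed x∈xs))

module FiniteSums {c ℓ} (R : CommutativeRing c ℓ) {a ℓ₁} (S : Setoid a ℓ₁) where
  open CommutativeRing R
  open Setoid S using () renaming (Carrier to A; _≈_ to _≈ₛ_)
  open Membership S using (_∈_)
  open UniqueS S using (Unique)
  open import Relation.Binary.Reasoning.Setoid setoid
  open import Algebra.Properties.CommutativeSemigroup +-commutativeSemigroup using (interchange)
  open PermutationProps setoid using (foldr-commMonoid)

  ∑ : (A → Carrier) → List A → Carrier
  ∑ g = foldr (λ x s → g x + s) 0#

  ∑-cong-∈ : ∀ {g h} xs → (∀ {x} → x ∈ xs → g x ≈ h x) → ∑ g xs ≈ ∑ h xs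
  ∑-cong-∈ []       g≈h = refl
  ∑-cong-∈ (x ∷ xs) g≈h = +-cong (g≈h (here (Setoid.refl S))) (∑-cong-∈ xs (g≈h ∘ there))

  ∑-+ : ∀ g h xs → ∑ (λ x → g x + h x) xs ≈ ∑ g xs + ∑ h xs
  ∑-+ g h []       = sym (+-identityˡ _)
  ∑-+ g h (x ∷ xs) = trans (+-congˡ (∑-+ g h xs)) (interchange _ _ _ _)

  ∑-*ˡ : ∀ b g xs → ∑ (λ x → b * g x) xs ≈ b * ∑ g xs
  ∑-*ˡ b g []       = sym (zeroʳ b)
  ∑-*ˡ b g (x ∷ xs) = trans (+-congˡ (∑-*ˡ b g xs)) (sym (distribˡ _ _ _))

  ∑-doubling : ∀ {g h σ} xs → (∀ x → g x ≈ h x + h (σ x)) → ∑ (h ∘ σ) xs ≈ ∑ h xs →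
               ∑ g xs ≈ (1# + 1#) * ∑ h xs
  ∑-doubling {g} {h} {σ} xs split σ-invariant = begin
    ∑ g xs                            ≈⟨ ∑-cong-∈ xs (λ {x} _ → split x) ⟩
    ∑ (λ x → h x + h (σ x)) xs        ≈⟨ ∑-+ h (h ∘ σ) xs ⟩
    ∑ h xs + ∑ (h ∘ σ) xs             ≈⟨ +-congˡ σ-invariant ⟩
    ∑ h xs + ∑ h xs                   ≈⟨ +-cong (*-identityˡ _) (*-identityˡ _) ⟨
    1# * ∑ h xs + 1# * ∑ h xs         ≈⟨ distribʳ _ 1# 1# ⟨
    (1# + 1#) * ∑ h xs                ∎

  ∑-↭ : ∀ {g} → g Preserves _≈ₛ_ ⟶ _≈_ → ∀ {xs ys} → Permutation._↭_ S xs ys → ∑ g xs ≈ ∑ g ys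
  ∑-↭ {g} g-cong {xs} {ys} xs↭ys = begin
    ∑ g xs                  ≡⟨ foldr-map _+_ g 0# xs ⟨
    foldr _+_ 0# (map g xs) ≈⟨ foldr-commMonoid +-isCommutativeMonoid
                                 (PermutationProps.map⁺ S setoid g-cong xs↭ys) ⟩
    foldr _+_ 0# (map g ys) ≡⟨ foldr-map _+_ g 0# ys ⟩
    ∑ g ys                  ∎

  ∑-∘-involution : ∀ {g f} → g Preserves _≈ₛ_ ⟶ _≈_ → f Preserves _≈ₛ_ ⟶ _≈ₛ_ → (∀ x → f (f x) ≈ₛ x) →
                   ∀ {xs} → Unique xs → (∀ {x} → x ∈ xs → f x ∈ xs) → ∑ (g ∘ f) xs ≈ ∑ g xs
  ∑-∘-involution {g} {f} g-cong f-cong ff≈id {xs} uxs closed = begin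
    ∑ (g ∘ f) xs  ≡⟨ foldr-map (λ x s → g x + s) f 0# xs ⟨
    ∑ g (map f xs) ≈⟨ ∑-↭ g-cong (involution-map-↭ S f-cong ff≈id uxs closed) ⟩
    ∑ g xs         ∎

module RingProperties {c ℓ} (R : CommutativeRing c ℓ) where
  open CommutativeRing R
  open import Relation.Binary.Reasoning.Setoid setoid
  open import Algebra.Properties.Ring ring using (-‿distribˡ-*; -‿distribʳ-*; [y-z]x≈yx-zx)
  open import Algebra.Properties.Group +-group using (x∙y⁻¹≈ε⇒x≈y; ⁻¹-involutive; ∙-cancelˡ)

  -x*-y≈x*y : ∀ x y → (- x) * (- y) ≈ x * y
  -x*-y≈x*y x y = begin
    (- x) * (- y) ≈⟨ -‿distribˡ-* x (- y) ⟨
    - (x * - y)   ≈⟨ -‿cong (-‿distribʳ-* x y) ⟨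
    - - (x * y)   ≈⟨ ⁻¹-involutive (x * y) ⟩
    x * y         ∎

  y-x+x≈y : ∀ x y → (y - x) + x ≈ y
  y-x+x≈y x y = trans (+-assoc y (- x) x) (trans (+-congˡ (-‿inverseˡ x)) (+-identityʳ y))

  y-[y-x]≈x : ∀ x y → y - (y - x) ≈ x
  y-[y-x]≈x x y = ∙-cancelˡ (y - x) _ _ (begin
    (y - x) + (y - (y - x)) ≈⟨ +-comm _ _ ⟩
    (y - (y - x)) + (y - x) ≈⟨ y-x+x≈y (y - x) y ⟩
    y                       ≈⟨ y-x+x≈y x y ⟨
    (y - x) + x             ∎)

  a*s≈b*s⇒s≈0 : IsIntegralDomain R → ∀ {a b s} → ¬ a ≈ b → a * s ≈ b * s → s ≈ 0#
  a*s≈b*s⇒s≈0 dom {a} {b} {s} a≉b as≈bs =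
    [ (λ a-b≈0 → contradiction (x∙y⁻¹≈ε⇒x≈y a b a-b≈0) a≉b) , id ]′
      (IsIntegralDomain.noZeroDivisors dom (a - b) s [a-b]s≈0)
    where
      [a-b]s≈0 : (a - b) * s ≈ 0#
      [a-b]s≈0 = trans ([y-z]x≈yx-zx s a b) (trans (+-congʳ as≈bs) (-‿inverseʳ (b * s)))

fuel-xyz : ∀ {k} l m n → suc l ℕ.+ suc m ℕ.+ suc n < suc k →
           suc (suc l) ℕ.+ m ℕ.+ n < k × l ℕ.+ suc (suc m) ℕ.+ n < k ×
           l ℕ.+ m ℕ.+ suc (suc n) < k × l ℕ.+ m ℕ.+ n < k
fuel-xyz {k} l m n h =
  deg+2<k , ≡.subst (_< k) (deg-y l m n) deg+2<k , ≡.subst (_< k) (deg-z l m n) deg+2<k ,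
  ℕ.<-trans (ℕ.n<1+n _) (ℕ.<-trans (ℕ.n<1+n _) deg+2<k)
  where
    deg-xyz : ∀ l m n → l ℕ.+ suc m ℕ.+ suc n ≡ suc (suc (l ℕ.+ m ℕ.+ n))
    deg-xyz = solve-∀
    deg-y : ∀ l m n → suc (suc (l ℕ.+ m ℕ.+ n)) ≡ l ℕ.+ suc (suc m) ℕ.+ n
    deg-y = solve-∀
    deg-z : ∀ l m n → suc (suc (l ℕ.+ m ℕ.+ n)) ≡ l ℕ.+ m ℕ.+ suc (suc n)
    deg-z = solve-∀
    deg+2<k : suc (suc l) ℕ.+ m ℕ.+ n < k
    deg+2<k = ≡.subst (_< k) (deg-xyz l m n) (ℕ.≤-pred h)

fuel-xy : ∀ {k} l m → suc l ℕ.+ suc m ℕ.+ 0 < suc k → l ℕ.+ m ℕ.+ 1 < k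
fuel-xy {k} l m h = ≡.subst (_< k) (deg-xy l m) (ℕ.≤-pred h)
  where
    deg-xy : ∀ l m → l ℕ.+ suc m ℕ.+ 0 ≡ l ℕ.+ m ℕ.+ 1
    deg-xy = solve-∀

fuel-xz : ∀ {k} l n → suc l ℕ.+ 0 ℕ.+ suc n < suc k → l ℕ.+ 1 ℕ.+ n < k
fuel-xz {k} l n h = ≡.subst (_< k) (deg-xz l n) (ℕ.≤-pred h)
  where
    deg-xz : ∀ l n → l ℕ.+ 0 ℕ.+ suc n ≡ l ℕ.+ 1 ℕ.+ n
    deg-xz = solve-∀

module OrbitSums {c ℓ} (R : CommutativeRing c ℓ) (κ : CommutativeRing.Carrier R) where
  open CommutativeRing R
  open Markoff R κ
  open RingProperties R
  open FiniteSums R PtSetoid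
  open Membership PtSetoid using (_∈_)
  open Setoid PtSetoid using () renaming (refl to ≈³-refl)
  open import Relation.Binary.Reasoning.Setoid setoid
  open import Algebra.Solver.Ring.NaturalCoefficients.Default commutativeSemiring
  open import Algebra.Properties.Group +-group using (∙-cancelˡ)

  ^-cong : ∀ {a b} n → a ≈ b → a ^ n ≈ b ^ n
  ^-cong zero    a≈b = refl
  ^-cong (suc n) a≈b = *-cong a≈b (^-cong n a≈b)

  monomial : ℕ → ℕ → ℕ → Pt → Carrier
  monomial l m n (x , y , z) = (x ^ l) * ((y ^ m) * (z ^ n))

  monomial-cong : ∀ l m n {p q} → p ≈³ q → monomial l m n p ≈ monomial l m n q
  monomial-cong l m n (x≈ , y≈ , z≈) = *-cong (^-cong l x≈) (*-cong (^-cong m y≈) (^-cong n z≈))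

  eval-++ : ∀ f g pt → eval (f ++ g) pt ≈ eval f pt + eval g pt
  eval-++ []      g pt = sym (+-identityˡ _)
  eval-++ (_ ∷ f) g pt = trans (+-congˡ (eval-++ f g pt)) (sym (+-assoc _ _ _))

  eval-scale : ∀ b f pt → eval (scale b f) pt ≈ b * eval f pt
  eval-scale b []                    pt = sym (zeroʳ b)
  eval-scale b ((a , l , m , n) ∷ f) pt = begin
    (b * a) * monomial l m n pt + eval (scale b f) pt ≈⟨ +-cong (*-assoc _ _ _) (eval-scale b f pt) ⟩
    b * (a * monomial l m n pt) + b * eval f pt       ≈⟨ distribˡ b _ _ ⟨
    b * (a * monomial l m n pt + eval f pt)           ∎

  eval-mulX : ∀ f x y z → eval (mulX f) (x , y , z) ≈ x * eval f (x , y , z)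
  eval-mulX []                    x y z = sym (zeroʳ x)
  eval-mulX ((a , l , m , n) ∷ f) x y z = begin
    a * ((x * X) * YZ) + eval (mulX f) (x , y , z)
      ≈⟨ +-cong (solve 4 (λ a x X YZ → a :* ((x :* X) :* YZ) := x :* (a :* (X :* YZ))) refl a x X YZ)
                (eval-mulX f x y z) ⟩
    x * (a * (X * YZ)) + x * eval f (x , y , z)     ≈⟨ distribˡ x _ _ ⟨
    x * (a * (X * YZ) + eval f (x , y , z))         ∎
    where
      X  = x ^ l
      YZ = (y ^ m) * (z ^ n)

  _≟ₑ_ : DecidableEquality (ℕ × ℕ × ℕ)
  _≟ₑ_ = ≡-dec ℕ._≟_ (≡-dec ℕ._≟_ ℕ._≟_)

  coeff-∷-≡ : ∀ a l m n f → coeff ((a , l , m , n) ∷ f) l m n ≡ a + coeff f l m n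
  coeff-∷-≡ a l m n f with l ℕ.≟ l | m ℕ.≟ m | n ℕ.≟ n
  ... | yes _ | yes _ | yes _ = ≡.refl
  ... | no l≢l | _     | _     = contradiction ≡.refl l≢l
  ... | yes _ | no m≢m | _     = contradiction ≡.refl m≢m
  ... | yes _ | yes _ | no n≢n = contradiction ≡.refl n≢n

  coeff-∷-≢ : ∀ a l′ m′ n′ f l m n → (l′ , m′ , n′) ≢ (l , m , n) →
              coeff ((a , l′ , m′ , n′) ∷ f) l m n ≡ coeff f l m n
  coeff-∷-≢ a l′ m′ n′ f l m n e≢ with l′ ℕ.≟ l | m′ ℕ.≟ m | n′ ℕ.≟ n
  ... | yes ≡.refl | yes ≡.refl | yes ≡.refl = contradiction ≡.refl e≢
  ... | no _  | _     | _     = ≡.refl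
  ... | yes _ | no _  | _     = ≡.refl
  ... | yes _ | yes _ | no _  = ≡.refl

  otherExponents? : ∀ l m n → U.Decidable (λ (t : Term) → proj₂ t ≢ (l , m , n))
  otherExponents? l m n t = ¬? (proj₂ t ≟ₑ (l , m , n))

  withoutExponents : ℕ → ℕ → ℕ → Poly → Poly
  withoutExponents l m n = filter (otherExponents? l m n)

  eval-split : ∀ l m n f pt →
    eval f pt ≈ coeff f l m n * monomial l m n pt + eval (withoutExponents l m n f) pt
  eval-split l m n [] pt = sym (trans (+-identityʳ _) (zeroˡ _))
  eval-split l m n ((a , l′ , m′ , n′) ∷ f) pt with (l′ , m′ , n′) ≟ₑ (l , m , n)
  ... | yes ≡.refl = begin
    a * M + eval f pt                               ≈⟨ +-congˡ (eval-split l m n f pt) ⟩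
    a * M + (coeff f l m n * M + eval f′ pt)
      ≈⟨ solve 4 (λ a c M r → a :* M :+ (c :* M :+ r) := (a :+ c) :* M :+ r) refl a (coeff f l m n) M (eval f′ pt) ⟩
    (a + coeff f l m n) * M + eval f′ pt
      ≡⟨ ≡.cong (λ c → c * M + eval f′ pt) (coeff-∷-≡ a l m n f) ⟨
    coeff ((a , l , m , n) ∷ f) l m n * M + eval f′ pt ∎
    where
      M  = monomial l m n pt
      f′ = withoutExponents l m n f
  ... | no e≢ = begin
    a * M′ + eval f pt                              ≈⟨ +-congˡ (eval-split l m n f pt) ⟩
    a * M′ + (coeff f l m n * M + eval f′ pt)
      ≈⟨ solve 5 (λ a M′ c M r → a :* M′ :+ (c :* M :+ r) := c :* M :+ (a :* M′ :+ r))
                 refl a M′ (coeff f l m n) M (eval f′ pt) ⟩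
    coeff f l m n * M + (a * M′ + eval f′ pt)
      ≡⟨ ≡.cong (λ c → c * M + (a * M′ + eval f′ pt)) (coeff-∷-≢ a l′ m′ n′ f l m n e≢) ⟨
    coeff ((a , l′ , m′ , n′) ∷ f) l m n * M + (a * M′ + eval f′ pt) ∎
    where
      M  = monomial l m n pt
      M′ = monomial l′ m′ n′ pt
      f′ = withoutExponents l m n f

  coeff-withoutExponents-≡ : ∀ l m n f → coeff (withoutExponents l m n f) l m n ≡ 0#
  coeff-withoutExponents-≡ l m n [] = ≡.refl
  coeff-withoutExponents-≡ l m n ((a , l′ , m′ , n′) ∷ f) with (l′ , m′ , n′) ≟ₑ (l , m , n)
  ... | yes _  = coeff-withoutExponents-≡ l m n f
  ... | no e≢ = ≡.trans (coeff-∷-≢ a l′ m′ n′ _ l m n e≢) (coeff-withoutExponents-≡ l m n f)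

  coeff-withoutExponents-≢ : ∀ l m n f l′ m′ n′ → (l′ , m′ , n′) ≢ (l , m , n) →
    coeff (withoutExponents l m n f) l′ m′ n′ ≡ coeff f l′ m′ n′
  coeff-withoutExponents-≢ l m n [] l′ m′ n′ e≢ = ≡.refl
  coeff-withoutExponents-≢ l m n ((a , l₀ , m₀ , n₀) ∷ f) l′ m′ n′ e≢
    with (l₀ , m₀ , n₀) ≟ₑ (l , m , n) | (l₀ , m₀ , n₀) ≟ₑ (l′ , m′ , n′)
  ... | yes ≡.refl | _ = ≡.trans (coeff-withoutExponents-≢ l m n f l′ m′ n′ e≢)
                                 (≡.sym (coeff-∷-≢ a l m n f l′ m′ n′ (e≢ ∘ ≡.sym)))
  ... | no _ | yes ≡.refl = ≡.trans (coeff-∷-≡ a l′ m′ n′ _)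
                              (≡.trans (≡.cong (a +_) (coeff-withoutExponents-≢ l m n f l′ m′ n′ e≢))
                                 (≡.sym (coeff-∷-≡ a l′ m′ n′ f)))
  ... | no _ | no e₀≢ = ≡.trans (coeff-∷-≢ a l₀ m₀ n₀ _ l′ m′ n′ e₀≢)
                          (≡.trans (coeff-withoutExponents-≢ l m n f l′ m′ n′ e≢)
                             (≡.sym (coeff-∷-≢ a l₀ m₀ n₀ f l′ m′ n′ e₀≢)))

  withoutExponents-≈ₚ : ∀ l m n f g → f ≈ₚ g → withoutExponents l m n f ≈ₚ withoutExponents l m n g
  withoutExponents-≈ₚ l m n f g f≈g l′ m′ n′ with (l′ , m′ , n′) ≟ₑ (l , m , n)
  ... | yes ≡.refl =
    reflexive (≡.trans (coeff-withoutExponents-≡ l m n f) (≡.sym (coeff-withoutExponents-≡ l m n g)))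
  ... | no e≢ = begin
    coeff (withoutExponents l m n f) l′ m′ n′ ≡⟨ coeff-withoutExponents-≢ l m n f l′ m′ n′ e≢ ⟩
    coeff f l′ m′ n′                           ≈⟨ f≈g l′ m′ n′ ⟩
    coeff g l′ m′ n′                           ≡⟨ coeff-withoutExponents-≢ l m n g l′ m′ n′ e≢ ⟨
    coeff (withoutExponents l m n g) l′ m′ n′  ∎

  length-withoutExponents : ∀ l m n f → length (withoutExponents l m n f) ≤ length f
  length-withoutExponents l m n = length-filter (otherExponents? l m n)

  withoutExponents-∷ : ∀ a l m n f →
                       withoutExponents l m n ((a , l , m , n) ∷ f) ≡ withoutExponents l m n f
  withoutExponents-∷ a l m n f = filter-reject (otherExponents? l m n) (λ e≢ → e≢ ≡.refl)

  -- Induction on total length: deleting every term with the exponents of a head term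
  -- keeps the coefficients equal and shortens the lists.
  eval-resp-≈ₚ : ∀ f g → f ≈ₚ g → ∀ pt → eval f pt ≈ eval g pt
  eval-resp-≈ₚ f g f≈g pt = go (length f ℕ.+ length g) f g ℕ.≤-refl f≈g
    where
      peel : ∀ l m n f g → f ≈ₚ g →
             eval (withoutExponents l m n f) pt ≈ eval (withoutExponents l m n g) pt → eval f pt ≈ eval g pt
      peel l m n f g f≈g rest = begin
        eval f pt                                                              ≈⟨ eval-split l m n f pt ⟩
        coeff f l m n * monomial l m n pt + eval (withoutExponents l m n f) pt ≈⟨ +-cong (*-congʳ (f≈g l m n)) rest ⟩
        coeff g l m n * monomial l m n pt + eval (withoutExponents l m n g) pt ≈⟨ eval-split l m n g pt ⟨
        eval g pt                                                              ∎
      go : ∀ k f g → length f ℕ.+ length g ≤ k → f ≈ₚ g → eval f pt ≈ eval g pt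
      go _ [] [] _ _ = refl
      go (suc k) (t@(a , l , m , n) ∷ f) g (s≤s len) f≈g =
        peel l m n (t ∷ f) g f≈g (go k (withoutExponents l m n (t ∷ f)) (withoutExponents l m n g) len′
                                    (withoutExponents-≈ₚ l m n (t ∷ f) g f≈g))
        where
          len′ : length (withoutExponents l m n (t ∷ f)) ℕ.+ length (withoutExponents l m n g) ≤ k
          len′ = ≡.subst (λ h → length h ℕ.+ _ ≤ k) (≡.sym (withoutExponents-∷ a l m n f))
                   (ℕ.≤-trans (ℕ.+-mono-≤ (length-withoutExponents l m n f) (length-withoutExponents l m n g))
                              len)
      go (suc k) [] (t@(a , l , m , n) ∷ g) (s≤s len) f≈g =
        peel l m n [] (t ∷ g) f≈g (go k [] (withoutExponents l m n (t ∷ g)) len′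
                                    (withoutExponents-≈ₚ l m n [] (t ∷ g) f≈g))
        where
          len′ : length (withoutExponents l m n (t ∷ g)) ≤ k
          len′ = ≡.subst (λ h → length h ≤ k) (≡.sym (withoutExponents-∷ a l m n g))
                   (ℕ.≤-trans (length-withoutExponents l m n g) len)

  inM-resp : ∀ {p q} → p ≈³ q → inM p → inM q
  inM-resp (x≈ , y≈ , z≈) p∈M =
    trans (sym (+-cong (*-cong x≈ x≈) (+-cong (*-cong y≈ y≈) (*-cong z≈ z≈))))
      (trans p∈M (+-congʳ (*-cong x≈ (*-cong y≈ z≈))))

  private
    rearrange : ∀ {A A′ B B′} → A ≈ A′ → B ≈ B′ → A ≈ B + κ → A′ ≈ B′ + κ
    rearrange A≈ B≈ A≈B+κ = trans (sym A≈) (trans A≈B+κ (+-congʳ B≈))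

  inM-swap₁₂ : ∀ {x y z} → inM (x , y , z) → inM (y , x , z)
  inM-swap₁₂ {x} {y} {z} = rearrange
    (solve 3 (λ x y z → x :* x :+ (y :* y :+ z :* z) := y :* y :+ (x :* x :+ z :* z)) refl x y z)
    (solve 3 (λ x y z → x :* (y :* z) := y :* (x :* z)) refl x y z)

  inM-swap₂₃ : ∀ {x y z} → inM (x , y , z) → inM (x , z , y)
  inM-swap₂₃ {x} {y} {z} = rearrange (+-congˡ (+-comm _ _)) (*-congˡ (*-comm y z))

  inM-neg₂₃ : ∀ {x y z} → inM (x , y , z) → inM (x , - y , - z)
  inM-neg₂₃ {x} {y} {z} = rearrange (+-congˡ (sym (+-cong (-x*-y≈x*y y y) (-x*-y≈x*y z z))))
                                    (*-congˡ (sym (-x*-y≈x*y y z)))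

  -- x and w = yz − x are the two roots of T² − yz·T + (y² + z² − κ).
  inM-vieta₁ : ∀ {x y z} → inM (x , y , z) → inM ((y * z) - x , y , z)
  inM-vieta₁ {x} {y} {z} x∈M = begin
    w * w + (y * y + z * z) ≈⟨ +-congˡ y²+z²≈xw+κ ⟩
    w * w + (x * w + κ)     ≈⟨ solve 3 (λ w x k → w :* w :+ (x :* w :+ k) := w :* (w :+ x) :+ k) refl w x κ ⟩
    w * (w + x) + κ         ≈⟨ +-congʳ (*-congˡ (y-x+x≈y x (y * z))) ⟩
    w * (y * z) + κ         ∎
    where
      w = (y * z) - x
      y²+z²≈xw+κ : y * y + z * z ≈ x * w + κ
      y²+z²≈xw+κ = ∙-cancelˡ (x * x) _ _ (begin
        x * x + (y * y + z * z) ≈⟨ x∈M ⟩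
        x * (y * z) + κ         ≈⟨ +-congʳ (*-congˡ (y-x+x≈y x (y * z))) ⟨
        x * (w + x) + κ         ≈⟨ solve 3 (λ w x k → x :* (w :+ x) :+ k := x :* x :+ (x :* w :+ k)) refl w x κ ⟩
        x * x + (x * w + κ)     ∎)

  actGen-inM : ∀ γ {p} → inM p → inM (actGen γ p)
  actGen-inM vieta₁   = inM-vieta₁
  actGen-inM vieta₂   = inM-swap₁₂ ∘ inM-vieta₁ ∘ inM-swap₁₂
  actGen-inM vieta₃   = inM-swap₂₃ ∘ inM-swap₁₂ ∘ inM-vieta₁ ∘ inM-swap₁₂ ∘ inM-swap₂₃
  actGen-inM perm-xzy = inM-swap₂₃
  actGen-inM perm-yxz = inM-swap₁₂
  actGen-inM perm-yzx = inM-swap₂₃ ∘ inM-swap₁₂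
  actGen-inM perm-zxy = inM-swap₁₂ ∘ inM-swap₂₃
  actGen-inM perm-zyx = inM-swap₁₂ ∘ inM-swap₂₃ ∘ inM-swap₁₂
  actGen-inM negYZ    = inM-neg₂₃

  act-inM : ∀ w {p} → inM p → inM (act w p)
  act-inM []      p∈M = p∈M
  act-inM (γ ∷ w) p∈M = actGen-inM γ (act-inM w p∈M)

  actGen-cong : ∀ γ {p q} → p ≈³ q → actGen γ p ≈³ actGen γ q
  actGen-cong vieta₁   (x≈ , y≈ , z≈) = +-cong (*-cong y≈ z≈) (-‿cong x≈) , y≈ , z≈
  actGen-cong vieta₂   (x≈ , y≈ , z≈) = x≈ , +-cong (*-cong x≈ z≈) (-‿cong y≈) , z≈
  actGen-cong vieta₃   (x≈ , y≈ , z≈) = x≈ , y≈ , +-cong (*-cong x≈ y≈) (-‿cong z≈)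
  actGen-cong perm-xzy (x≈ , y≈ , z≈) = x≈ , z≈ , y≈
  actGen-cong perm-yxz (x≈ , y≈ , z≈) = y≈ , x≈ , z≈
  actGen-cong perm-yzx (x≈ , y≈ , z≈) = y≈ , z≈ , x≈
  actGen-cong perm-zxy (x≈ , y≈ , z≈) = z≈ , x≈ , y≈
  actGen-cong perm-zyx (x≈ , y≈ , z≈) = z≈ , y≈ , x≈
  actGen-cong negYZ    (x≈ , y≈ , z≈) = x≈ , -‿cong y≈ , -‿cong z≈

  monomial-xyz-on-M : ∀ l m n {p} → inM p →
    monomial (suc l) (suc m) (suc n) p ≈
    monomial (suc (suc l)) m n p + (monomial l (suc (suc m)) n p +
      (monomial l m (suc (suc n)) p + (- κ) * monomial l m n p))
  monomial-xyz-on-M l m n {x , y , z} p∈M = sym (begin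
    (x * (x * X)) * (Y * Z) + (X * ((y * (y * Y)) * Z) + (X * (Y * (z * (z * Z))) + (- κ) * Q))
      ≈⟨ solve 7 (λ x y z X Y Z N →
           (x :* (x :* X)) :* (Y :* Z) :+ (X :* ((y :* (y :* Y)) :* Z) :+
             (X :* (Y :* (z :* (z :* Z))) :+ N :* (X :* (Y :* Z))))
           := (X :* (Y :* Z)) :* (x :* x :+ (y :* y :+ z :* z)) :+ N :* (X :* (Y :* Z))) refl x y z X Y Z (- κ) ⟩
    Q * (x * x + (y * y + z * z)) + (- κ) * Q ≈⟨ +-congʳ (*-congˡ p∈M) ⟩
    Q * (x * (y * z) + κ) + (- κ) * Q
      ≈⟨ solve 6 (λ x y z Q k N → Q :* (x :* (y :* z) :+ k) :+ N :* Q := Q :* (x :* (y :* z)) :+ (k :+ N) :* Q)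
                 refl x y z Q κ (- κ) ⟩
    Q * (x * (y * z)) + (κ - κ) * Q           ≈⟨ +-congˡ (trans (*-congʳ (-‿inverseʳ κ)) (zeroˡ Q)) ⟩
    Q * (x * (y * z)) + 0#                    ≈⟨ +-identityʳ _ ⟩
    Q * (x * (y * z))
      ≈⟨ solve 6 (λ x y z X Y Z → (X :* (Y :* Z)) :* (x :* (y :* z)) := (x :* X) :* ((y :* Y) :* (z :* Z)))
                 refl x y z X Y Z ⟩
    (x * X) * ((y * Y) * (z * Z))             ∎)
    where
      X = x ^ l
      Y = y ^ m
      Z = z ^ n
      Q = X * (Y * Z)

  monomial-xy : ∀ l m p →
    monomial (suc l) (suc m) 0 p ≈ monomial l m 1 p + monomial l m 1 (actGen vieta₃ p)
  monomial-xy l m (x , y , z) = sym (begin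
    X * (Y * (z * 1#)) + X * (Y * (w * 1#))
      ≈⟨ solve 5 (λ X Y z w o → X :* (Y :* (z :* o)) :+ X :* (Y :* (w :* o)) := X :* (Y :* ((w :+ z) :* o)))
                 refl X Y z w 1# ⟩
    X * (Y * ((w + z) * 1#)) ≈⟨ *-congˡ (*-congˡ (*-congʳ (y-x+x≈y z (x * y)))) ⟩
    X * (Y * ((x * y) * 1#))
      ≈⟨ solve 5 (λ X Y x y o → X :* (Y :* ((x :* y) :* o)) := (x :* X) :* ((y :* Y) :* o))
                 refl X Y x y 1# ⟩
    (x * X) * ((y * Y) * 1#) ∎)
    where
      X = x ^ l
      Y = y ^ m
      w = x * y - z

  monomial-xz : ∀ l n p →
    monomial (suc l) 0 (suc n) p ≈ monomial l 1 n p + monomial l 1 n (actGen vieta₂ p)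
  monomial-xz l n (x , y , z) = sym (begin
    X * ((y * 1#) * Z) + X * ((w * 1#) * Z)
      ≈⟨ solve 5 (λ X Z y w o → X :* ((y :* o) :* Z) :+ X :* ((w :* o) :* Z) := X :* (((w :+ y) :* o) :* Z))
                 refl X Z y w 1# ⟩
    X * (((w + y) * 1#) * Z) ≈⟨ *-congˡ (*-congʳ (*-congʳ (y-x+x≈y y (x * z)))) ⟩
    X * (((x * z) * 1#) * Z)
      ≈⟨ solve 5 (λ X Z x z o → X :* (((x :* z) :* o) :* Z) := (x :* X) :* (o :* (z :* Z)))
                 refl X Z x z 1# ⟩
    (x * X) * (1# * (z * Z)) ∎)
    where
      X = x ^ l
      Z = z ^ n
      w = x * z - y

  monomial-yz : ∀ m n p → monomial 0 m n p ≈ monomial 0 n m (actGen perm-xzy p)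
  monomial-yz m n (x , y , z) = *-congˡ (*-comm _ _)

  ∑-eval-++ : ∀ f g xs → ∑ (eval (f ++ g)) xs ≈ ∑ (eval f) xs + ∑ (eval g) xs
  ∑-eval-++ f g xs = trans (∑-cong-∈ xs (λ {pt} _ → eval-++ f g pt)) (∑-+ _ _ xs)

  ∑-eval-scale : ∀ b f xs → ∑ (eval (scale b f)) xs ≈ b * ∑ (eval f) xs
  ∑-eval-scale b f xs = trans (∑-cong-∈ xs (λ {pt} _ → eval-scale b f pt)) (∑-*ˡ b _ xs)

  ∑-eval-monomial : ∀ l m n xs → ∑ (eval ((1# , l , m , n) ∷ [])) xs ≈ ∑ (monomial l m n) xs
  ∑-eval-monomial l m n xs = ∑-cong-∈ xs (λ _ → trans (+-identityʳ _) (*-identityˡ _))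

  module Orbit {t ts} (t∈M : inM t) (enum : EnumeratesOrbit t ts) where

    orbitSum : Poly → Carrier
    orbitSum f = ∑ (eval f) ts

    member-inM : ∀ {p} → p ∈ ts → inM p
    member-inM {p} p∈ts with proj₁ (proj₂ enum) p p∈ts
    ... | w , _ , wt≈p = inM-resp wt≈p (act-inM w t∈M)

    member-first : ∀ {p} → p ∈ ts → proj₁ p ≈ proj₁ t
    member-first {p} p∈ts with proj₁ (proj₂ enum) p p∈ts
    ... | w , w∈Γx , wt≈p = trans (sym (proj₁ wt≈p)) (w∈Γx t)

    actGen-closed : ∀ γ → (∀ r → proj₁ (actGen γ r) ≡ proj₁ r) → ∀ {p} → p ∈ ts → actGen γ p ∈ ts
    actGen-closed γ γ-fixes-x {p} p∈ts with proj₁ (proj₂ enum) p p∈ts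
    ... | w , w∈Γx , wt≈p =
      proj₂ (proj₂ enum) _ (γ ∷ w , (λ r → trans (reflexive (γ-fixes-x (act w r))) (w∈Γx r)) , actGen-cong γ wt≈p)

    ∑-actGen : ∀ γ → (∀ r → proj₁ (actGen γ r) ≡ proj₁ r) → (∀ p → actGen γ (actGen γ p) ≈³ p) →
               ∀ {g} → g Preserves _≈³_ ⟶ _≈_ → ∑ (g ∘ actGen γ) ts ≈ ∑ g ts
    ∑-actGen γ γ-fixes-x γ-involutive g-cong =
      ∑-∘-involution g-cong (actGen-cong γ) γ-involutive (proj₁ enum) (actGen-closed γ γ-fixes-x)

    ∑-vieta₂ : ∀ {g} → g Preserves _≈³_ ⟶ _≈_ → ∑ (g ∘ actGen vieta₂) ts ≈ ∑ g ts
    ∑-vieta₂ = ∑-actGen vieta₂ (λ _ → ≡.refl) (λ (x , y , z) → refl , y-[y-x]≈x y (x * z) , refl)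

    ∑-vieta₃ : ∀ {g} → g Preserves _≈³_ ⟶ _≈_ → ∑ (g ∘ actGen vieta₃) ts ≈ ∑ g ts
    ∑-vieta₃ = ∑-actGen vieta₃ (λ _ → ≡.refl) (λ (x , y , z) → refl , refl , y-[y-x]≈x z (x * y))

    ∑-perm-xzy : ∀ {g} → g Preserves _≈³_ ⟶ _≈_ → ∑ (g ∘ actGen perm-xzy) ts ≈ ∑ g ts
    ∑-perm-xzy = ∑-actGen perm-xzy (λ _ → ≡.refl) (λ _ → ≈³-refl)

    ∑-monomial-yz : ∀ m n → ∑ (monomial 0 m n) ts ≈ ∑ (monomial 0 n m) ts
    ∑-monomial-yz m n = trans (∑-cong-∈ ts (λ {p} _ → monomial-yz m n p)) (∑-perm-xzy (monomial-cong 0 n m))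

    ∑-monomial≈∑-Φmono : ∀ k l m n → l ℕ.+ m ℕ.+ n < k → ∑ (monomial l m n) ts ≈ orbitSum (Φmono k l m n)
    ∑-monomial≈∑-Φmono (suc k) (suc l) (suc m) (suc n) deg<k
      with fuel-xyz l m n deg<k
    ... | <x , <y , <z , <κ = begin
      ∑ (monomial (suc l) (suc m) (suc n)) ts
        ≈⟨ ∑-cong-∈ ts (λ p∈ts → monomial-xyz-on-M l m n (member-inM p∈ts)) ⟩
      ∑ (λ p → monomial (suc (suc l)) m n p + (monomial l (suc (suc m)) n p +
                 (monomial l m (suc (suc n)) p + (- κ) * monomial l m n p))) ts
        ≈⟨ trans (∑-+ _ _ ts) (+-congˡ (trans (∑-+ _ _ ts) (+-congˡ (trans (∑-+ _ _ ts) (+-congˡ (∑-*ˡ _ _ ts)))))) ⟩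
      ∑ (monomial (suc (suc l)) m n) ts + (∑ (monomial l (suc (suc m)) n) ts +
        (∑ (monomial l m (suc (suc n))) ts + (- κ) * ∑ (monomial l m n) ts))
        ≈⟨ +-cong (∑-monomial≈∑-Φmono k _ _ _ <x) (+-cong (∑-monomial≈∑-Φmono k _ _ _ <y)
             (+-cong (∑-monomial≈∑-Φmono k _ _ _ <z) (*-congˡ (∑-monomial≈∑-Φmono k _ _ _ <κ)))) ⟩
      orbitSum A + (orbitSum B + (orbitSum C + (- κ) * orbitSum D))
        ≈⟨ trans (∑-eval-++ A _ ts) (+-congˡ (trans (∑-eval-++ B _ ts)
             (+-congˡ (trans (∑-eval-++ C _ ts) (+-congˡ (∑-eval-scale (- κ) D ts)))))) ⟨
      orbitSum (A ++ (B ++ (C ++ scale (- κ) D))) ∎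
      where
        A = Φmono k (suc (suc l)) m n
        B = Φmono k l (suc (suc m)) n
        C = Φmono k l m (suc (suc n))
        D = Φmono k l m n
    ∑-monomial≈∑-Φmono (suc k) (suc l) (suc m) zero deg<k = begin
      ∑ (monomial (suc l) (suc m) 0) ts        ≈⟨ ∑-doubling ts (monomial-xy l m) (∑-vieta₃ (monomial-cong l m 1)) ⟩
      (1# + 1#) * ∑ (monomial l m 1) ts        ≈⟨ *-congˡ (∑-monomial≈∑-Φmono k l m 1 (fuel-xy l m deg<k)) ⟩
      (1# + 1#) * orbitSum (Φmono k l m 1)     ≈⟨ ∑-eval-scale (1# + 1#) (Φmono k l m 1) ts ⟨
      orbitSum (scale (1# + 1#) (Φmono k l m 1)) ∎
    ∑-monomial≈∑-Φmono (suc k) (suc l) zero (suc n) deg<k = begin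
      ∑ (monomial (suc l) 0 (suc n)) ts        ≈⟨ ∑-doubling ts (monomial-xz l n) (∑-vieta₂ (monomial-cong l 1 n)) ⟩
      (1# + 1#) * ∑ (monomial l 1 n) ts        ≈⟨ *-congˡ (∑-monomial≈∑-Φmono k l 1 n (fuel-xz l n deg<k)) ⟩
      (1# + 1#) * orbitSum (Φmono k l 1 n)     ≈⟨ ∑-eval-scale (1# + 1#) (Φmono k l 1 n) ts ⟨
      orbitSum (scale (1# + 1#) (Φmono k l 1 n)) ∎
    ∑-monomial≈∑-Φmono (suc k) l@(suc _) zero zero _ = sym (∑-eval-monomial l 0 0 ts)
    ∑-monomial≈∑-Φmono (suc k) zero zero zero _ = sym (∑-eval-monomial 0 0 0 ts)
    ∑-monomial≈∑-Φmono (suc k) zero zero n@(suc _) _ =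
      trans (∑-monomial-yz 0 n) (sym (∑-eval-monomial 0 n 0 ts))
    ∑-monomial≈∑-Φmono (suc k) zero m@(suc _) n _ with m ℕ.<? n
    ... | yes _ = trans (∑-monomial-yz m n) (sym (∑-eval-monomial 0 n m ts))
    ... | no _  = sym (∑-eval-monomial 0 m n ts)

    orbitSum-resp-≈ₚ : ∀ f g → f ≈ₚ g → orbitSum f ≈ orbitSum g
    orbitSum-resp-≈ₚ f g f≈g = ∑-cong-∈ ts (λ {p} _ → eval-resp-≈ₚ f g f≈g p)

    orbitSum-Φx : ∀ f → orbitSum (Φx f) ≈ orbitSum f
    orbitSum-Φx []                    = refl
    orbitSum-Φx ((a , l , m , n) ∷ f) = begin
      orbitSum (scale a Φf ++ Φx f)                      ≈⟨ ∑-eval-++ (scale a Φf) (Φx f) ts ⟩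
      orbitSum (scale a Φf) + orbitSum (Φx f)            ≈⟨ +-cong (∑-eval-scale a Φf ts) (orbitSum-Φx f) ⟩
      a * orbitSum Φf + orbitSum f                       ≈⟨ +-congʳ (*-congˡ (∑-monomial≈∑-Φmono _ l m n (ℕ.n<1+n _))) ⟨
      a * ∑ (monomial l m n) ts + orbitSum f             ≈⟨ +-congʳ (∑-*ˡ a _ ts) ⟨
      ∑ (λ p → a * monomial l m n p) ts + orbitSum f     ≈⟨ ∑-+ _ _ ts ⟨
      orbitSum ((a , l , m , n) ∷ f)                     ∎
      where Φf = Φmono (suc (l ℕ.+ m ℕ.+ n)) l m n

    orbitSum-mulX : ∀ f → orbitSum (mulX f) ≈ proj₁ t * orbitSum f
    orbitSum-mulX f = begin
      orbitSum (mulX f)                   ≈⟨ ∑-cong-∈ ts (λ {(x , y , z)} p∈ts → trans (eval-mulX f x y z) (*-congʳ (member-first p∈ts))) ⟩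
      ∑ (λ p → proj₁ t * eval f p) ts     ≈⟨ ∑-*ˡ (proj₁ t) (eval f) ts ⟩
      proj₁ t * orbitSum f                ∎

proposition6p2 : ∀ {c ℓ} (R : CommutativeRing c ℓ) → IsIntegralDomain R →
    (κ : CommutativeRing.Carrier R) →
    let open CommutativeRing R
        open Markoff R κ
    in (f : Poly) (λ' : Carrier) →
       Φx (mulX f) ≈ₚ scale λ' (Φx f) →
       (t : Pt) → inM t → ¬ (proj₁ t ≈ λ') →
       (ts : List Pt) → EnumeratesOrbit t ts →
       sumOver f ts ≈ 0#
proposition6p2 R dom κ f λ' Φx[xf]≈λ'Φx[f] t t∈M α≉λ' ts enum =
  a*s≈b*s⇒s≈0 dom α≉λ' (begin
    proj₁ t * orbitSum f        ≈⟨ orbitSum-mulX f ⟨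
    orbitSum (mulX f)           ≈⟨ orbitSum-Φx (mulX f) ⟨
    orbitSum (Φx (mulX f))      ≈⟨ orbitSum-resp-≈ₚ (Φx (mulX f)) (scale λ' (Φx f)) Φx[xf]≈λ'Φx[f] ⟩
    orbitSum (scale λ' (Φx f))  ≈⟨ ∑-eval-scale λ' (Φx f) ts ⟩
    λ' * orbitSum (Φx f)        ≈⟨ *-congˡ (orbitSum-Φx f) ⟩
    λ' * orbitSum f             ∎)
  where
    open CommutativeRing R
    open Markoff R κ
    open RingProperties R using (a*s≈b*s⇒s≈0)
    open OrbitSums R κ
    open Orbit t∈M enum
    open import Relation.Binary.Reasoning.Setoid setoid
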